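{- Let $n\ge 1$ and $$g_{2n}(x_1,\ldots,x_{2n})=(x_1-x_2)(x_2-x_3)\cdots(x_{2n-1}-x_{2n})(x_{2n}-x_1)$$ in the polynomial ring in indeterminates $x_1,\ldots,x_{2n}$ over a field of characteristic different from $2$. Let $$\operatorname{Sym}(g_{2n})=\{\sigma\in S_{2n}\mid g_{2n}(x_{\sigma(1)},\ldots,x_{\sigma(2n)})=g_{2n}(x_1,\ldots,x_{2n})\}.$$ Then $\operatorname{Sym}(g_{2n})\cong D_{2n}$; more precisely $\operatorname{Sym}(g_{2n})$ is exactly the dihedral group $D_{2n}\subseteq S_{2n}$.
   Context: $D_{2n}$ denotes the dihedral group realized as the group of permutations of $\{1,\ldots,2n\}$ induced by the symmetries of a regular $2n$-gon whose vertices are labelled $1,2,\ldots,2n$ in cyclic order; equivalently the subgroup of $S_{2n}$ generated by the cyclic shift $i\mapsto i+1\pmod{2n}$ and the reflection fixing $1$ and sending $i\mapsto 2n+2-i$ for $2\le i\le 2n$. -}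

module Defs where

open import Level using (Level; _⊔_; suc)
open import Algebra.Bundles using (CommutativeRing)
open import Data.Nat as ℕ using (ℕ; zero; NonZero)
open import Data.Fin using (Fin; toℕ)
open import Data.Fin.Properties using () renaming (_≟_ to _≟ᶠ_)
open import Data.Nat.DivMod using (_mod_)
open import Data.Vec using (Vec; zipWith; replicate; tabulate)
open import Data.Vec.Properties using (≡-dec)
open import Data.List using (List; []; _∷_; map; concatMap; foldr; filter)
open import Data.List using (allFin)
open import Data.Product using (_×_; _,_; proj₁; proj₂; ∃)
open import Data.Bool using (if_then_else_)
open import Relation.Nullary using (¬_; does)
open import Relation.Binary.PropositionalEquality using (_≡_)
open import Data.Fin.Permutation using (Permutation′; _⟨$⟩ʳ_; _⟨$⟩ˡ_)

record Field (c ℓ : Level) : Set (suc (c ⊔ ℓ)) where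
  field
    commutativeRing : CommutativeRing c ℓ
  open CommutativeRing commutativeRing public
  field
    1≉0     : ¬ (1# ≈ 0#)
    inverse : ∀ x → ¬ (x ≈ 0#) → ∃ λ y → x * y ≈ 1#

CharNot2 : ∀ {c ℓ} → Field c ℓ → Set ℓ
CharNot2 F = ¬ (1# + 1# ≈ 0#) where open Field F

-- A polynomial is represented by a finite list of terms (coefficient,
-- exponent vector); the polynomial it denotes is determined by its
-- coefficient function, and two polynomials are equal iff all their
-- coefficients agree.

module Poly {c ℓ} (F : Field c ℓ) (m : ℕ) where
  open Field F

  Monomial : Set
  Monomial = Vec ℕ m

  Polynomial : Set c
  Polynomial = List (Carrier × Monomial)

  coeff : Polynomial → Monomial → Carrier
  coeff []             μ = 0#
  coeff ((a , ν) ∷ ts) μ =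
    if does (≡-dec ℕ._≟_ ν μ) then a + coeff ts μ else coeff ts μ

  _≈ₚ_ : Polynomial → Polynomial → Set ℓ
  p ≈ₚ q = ∀ μ → coeff p μ ≈ coeff q μ

  _*ₚ_ : Polynomial → Polynomial → Polynomial
  p *ₚ q = concatMap (λ t → map (λ s → (proj₁ t * proj₁ s , zipWith ℕ._+_ (proj₂ t) (proj₂ s))) q) p

  oneₚ : Polynomial
  oneₚ = (1# , replicate m 0) ∷ []

  unit : Fin m → Monomial
  unit i = tabulate (λ j → if does (j ≟ᶠ i) then 1 else 0)

  diffVar : Fin m → Fin m → Polynomial
  diffVar i j = (1# , unit i) ∷ (- 1# , unit j) ∷ []

-- Labels 1,…,2n are represented 0-indexed by Fin (2n) (label k ↦ k-1).

rot : (m : ℕ) .{{_ : NonZero m}} → Fin m → Fin m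
rot m i = (ℕ.suc (toℕ i)) mod m

-- reflection fixing label 1 and sending label i ↦ 2n+2-i;
-- 0-indexed: j ↦ (m - j) mod m
refl′ : (m : ℕ) .{{_ : NonZero m}} → Fin m → Fin m
refl′ m i = (m ℕ.∸ toℕ i) mod m

gσ : ∀ {c ℓ} (F : Field c ℓ) (m : ℕ) .{{_ : NonZero m}} →
     Permutation′ m → Poly.Polynomial F m
gσ F m σ = foldr _*ₚ_ oneₚ
  (map (λ i → diffVar (σ ⟨$⟩ʳ i) (σ ⟨$⟩ʳ rot m i)) (allFin m))
  where open Poly F m

g : ∀ {c ℓ} (F : Field c ℓ) (m : ℕ) .{{_ : NonZero m}} → Poly.Polynomial F m
g F m = foldr _*ₚ_ oneₚ (map (λ i → diffVar i (rot m i)) (allFin m))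
  where open Poly F m

InSym : ∀ {c ℓ} (F : Field c ℓ) (m : ℕ) .{{_ : NonZero m}} → Permutation′ m → Set ℓ
InSym F m σ = gσ F m σ ≈ₚ g F m
  where open Poly F m

data InDihedral (m : ℕ) .{{_ : NonZero m}} : Permutation′ m → Set where
  gen-id   : ∀ σ → (∀ i → σ ⟨$⟩ʳ i ≡ i) → InDihedral m σ
  gen-rot  : ∀ σ → (∀ i → σ ⟨$⟩ʳ i ≡ rot m i) → InDihedral m σ
  gen-refl : ∀ σ → (∀ i → σ ⟨$⟩ʳ i ≡ refl′ m i) → InDihedral m σ
  gen-comp : ∀ σ τ ρ → InDihedral m τ → InDihedral m ρ →
             (∀ i → σ ⟨$⟩ʳ i ≡ τ ⟨$⟩ʳ (ρ ⟨$⟩ʳ i)) → InDihedral m σ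
  gen-inv  : ∀ σ τ → InDihedral m τ →
             (∀ i → σ ⟨$⟩ʳ i ≡ τ ⟨$⟩ˡ i) → InDihedral m σ

{-# OPTIONS --safe #-}
module Submission where

-- Colour σ(i) and σ(i+1) by 0 and every other index by ±1 alternately.  At
-- this point g ∘ σ vanishes (its factor at i does), whereas g does not unless
-- σ(i) and σ(i+1) are adjacent: in characteristic ≠ 2 the values 0, 1, −1 are
-- distinct, and on a cycle of even length the alternating colours never clash.
-- So every σ ∈ Sym(g) maps edges of the cycle to edges; by induction around the
-- cycle it does so consistently in one direction, which makes it a rotation,
-- possibly after the reflection.  Conversely the rotation permutes the factors
-- of g and the reflection reverses each of them, giving the sign (−1)^{2n} = 1.

open import Defs
open import Level using (Level; _⊔_)
open import Algebra.Bundles using (Monoid; CommutativeMonoid; Semiring)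
open import Algebra.Structures using (IsCommutativeMonoid)
open import Relation.Binary.Structures using (IsEquivalence)
import Algebra.Definitions.RawMonoid as RawMonoidDefinitions
import Algebra.Properties.CommutativeMonoid.Sum as CommutativeMonoidSum
import Algebra.Properties.CommutativeSemigroup as CommutativeSemigroupProperties
import Algebra.Properties.Ring as RingProperties
import Algebra.Properties.Semiring.Exp as Exp
open import Data.Nat as ℕ using (ℕ; zero; suc; parity)
import Data.Nat.Properties as ℕ
open import Data.Nat.DivMod using (m<n⇒m%n≡m; n%n≡0; %-distribˡ-+; m%n%n≡m%n; [m+n]%n≡m%n)
open import Data.Fin using (Fin; zero; suc; toℕ; fromℕ<)
open import Data.Fin.Properties using (toℕ-injective; toℕ<n; toℕ-fromℕ<; fromℕ<-toℕ) renaming (_≟_ to _≟ᶠ_)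
open import Data.Fin.Permutation as Perm using (Permutation′; _⟨$⟩ʳ_; _⟨$⟩ˡ_; permutation; _∘ₚ_)
open import Data.Vec using (Vec; []; _∷_; zipWith; replicate; tabulate)
open import Data.Vec.Properties using (≡-dec; zipWith-comm; zipWith-assoc; zipWith-identityˡ)
open import Data.Vec.Functional as Vector using (Vector)
open import Data.List as List using (List; []; _∷_; _++_; map; concatMap; deduplicate; allFin)
open import Data.List.Properties using (map-tabulate)
open import Data.List.Membership.Propositional using (_∈_; _∉_)
open import Data.List.Membership.Propositional.Properties using (∈-++⁺ˡ; ∈-++⁺ʳ; ∈-deduplicate⁺)
open import Data.List.Relation.Unary.Any using (here; there)
open import Data.List.Relation.Unary.All.Properties using (All¬⇒¬Any)
open import Data.List.Relation.Unary.AllPairs using (_∷_)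
open import Data.List.Relation.Unary.Unique.Propositional using (Unique)
open import Data.List.Relation.Unary.Unique.DecPropositional.Properties using (deduplicate-!)
open import Data.Maybe using (Maybe; just; nothing)
open import Data.Parity.Base using (Parity; 0ℙ; 1ℙ; _⁻¹)
open import Data.Parity.Properties using (suc-homo-⁻¹; ⁻¹-selfInverse; p≢p⁻¹; *-homo-*)
open import Data.Product using (_×_; _,_; proj₂; ∃)
open import Data.Sum using (_⊎_; inj₁; inj₂)
open import Data.Bool using (true; false; if_then_else_; _∨_)
open import Data.Empty using (⊥-elim)
open import Function using (_∘_; id; case_of_)
open import Relation.Nullary using (Dec; ¬_; does; yes; no)
open import Relation.Binary.PropositionalEquality as ≡ using (_≡_; _≢_)

tabulate-const : ∀ {a} {A : Set a} k (x : A) → tabulate {n = k} (λ _ → x) ≡ replicate k x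
tabulate-const zero    x = ≡.refl
tabulate-const (suc k) x = ≡.cong (x ∷_) (tabulate-const k x)

foldr-map-allFin : ∀ {a b} {A : Set a} {B : Set b} (f : A → B → B) e {n} (h : Fin n → A) →
                   List.foldr f e (map h (allFin n)) ≡ Vector.foldr f e h
foldr-map-allFin f e {n} h = ≡.trans (≡.cong (List.foldr f e) (map-tabulate id h)) (foldr-tabulate n h)
  where
  foldr-tabulate : ∀ n (h : Fin n → _) → List.foldr f e (List.tabulate h) ≡ Vector.foldr f e h
  foldr-tabulate zero    h = ≡.refl
  foldr-tabulate (suc n) h = ≡.cong (f (h zero)) (foldr-tabulate n (h ∘ suc))

module _ {a ℓ} (M : Monoid a ℓ) where
  open Monoid M
  open RawMonoidDefinitions rawMonoid using (sum)
  open import Relation.Binary.Reasoning.Setoid setoid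

  sum-replicate-involutive : ∀ {x} n → x ∙ x ≈ ε → parity n ≡ 0ℙ → sum (Vector.replicate n x) ≈ ε
  sum-replicate-involutive zero                x∙x≈ε n-even = refl
  sum-replicate-involutive (suc zero)          x∙x≈ε ()
  sum-replicate-involutive {x} (suc (suc n))   x∙x≈ε n-even = begin
    x ∙ (x ∙ sum (Vector.replicate n x))  ≈⟨ assoc x x _ ⟨
    (x ∙ x) ∙ sum (Vector.replicate n x)  ≈⟨ ∙-congʳ x∙x≈ε ⟩
    ε ∙ sum (Vector.replicate n x)        ≈⟨ identityˡ _ ⟩
    sum (Vector.replicate n x)            ≈⟨ sum-replicate-involutive n x∙x≈ε n-even ⟩
    ε                                     ∎

module ListSum {c ℓ} (R : Semiring c ℓ) where
  open Semiring R
  open CommutativeSemigroupProperties +-commutativeSemigroup using (interchange)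

  private variable
    a : Level
    A B : Set a

  ∑ₗ : (A → Carrier) → List A → Carrier
  ∑ₗ f []       = 0#
  ∑ₗ f (x ∷ xs) = f x + ∑ₗ f xs

  ∑ₗ-cong : ∀ {f g : A → Carrier} xs → (∀ x → f x ≈ g x) → ∑ₗ f xs ≈ ∑ₗ g xs
  ∑ₗ-cong []       f≈g = refl
  ∑ₗ-cong (x ∷ xs) f≈g = +-cong (f≈g x) (∑ₗ-cong xs f≈g)

  ∑ₗ-map : ∀ (f : B → Carrier) (h : A → B) xs → ∑ₗ f (map h xs) ≡ ∑ₗ (f ∘ h) xs
  ∑ₗ-map f h []       = ≡.refl
  ∑ₗ-map f h (x ∷ xs) = ≡.cong (f (h x) +_) (∑ₗ-map f h xs)

  ∑ₗ-++ : ∀ (f : A → Carrier) xs ys → ∑ₗ f (xs ++ ys) ≈ ∑ₗ f xs + ∑ₗ f ys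
  ∑ₗ-++ f []       ys = sym (+-identityˡ _)
  ∑ₗ-++ f (x ∷ xs) ys = trans (+-congˡ (∑ₗ-++ f xs ys)) (sym (+-assoc _ _ _))

  ∑ₗ-concatMap : ∀ (f : B → Carrier) (h : A → List B) xs →
                 ∑ₗ f (concatMap h xs) ≈ ∑ₗ (∑ₗ f ∘ h) xs
  ∑ₗ-concatMap f h []       = refl
  ∑ₗ-concatMap f h (x ∷ xs) = trans (∑ₗ-++ f (h x) _) (+-congˡ (∑ₗ-concatMap f h xs))

  ∑ₗ-zero : ∀ (xs : List A) → ∑ₗ (λ _ → 0#) xs ≈ 0#
  ∑ₗ-zero []       = refl
  ∑ₗ-zero (x ∷ xs) = trans (+-identityˡ _) (∑ₗ-zero xs)

  ∑ₗ-+ : ∀ (f g : A → Carrier) xs → ∑ₗ (λ x → f x + g x) xs ≈ ∑ₗ f xs + ∑ₗ g xs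
  ∑ₗ-+ f g []       = sym (+-identityˡ _)
  ∑ₗ-+ f g (x ∷ xs) = trans (+-congˡ (∑ₗ-+ f g xs)) (interchange _ _ _ _)

  ∑ₗ-*ˡ : ∀ k (f : A → Carrier) xs → ∑ₗ (λ x → k * f x) xs ≈ k * ∑ₗ f xs
  ∑ₗ-*ˡ k f []       = sym (zeroʳ k)
  ∑ₗ-*ˡ k f (x ∷ xs) = trans (+-congˡ (∑ₗ-*ˡ k f xs)) (sym (distribˡ k _ _))

  ∑ₗ-swap : ∀ (h : A → B → Carrier) xs ys →
            ∑ₗ (λ x → ∑ₗ (h x) ys) xs ≈ ∑ₗ (λ y → ∑ₗ (λ x → h x y) xs) ys
  ∑ₗ-swap h []       ys = sym (∑ₗ-zero ys)
  ∑ₗ-swap h (x ∷ xs) ys = trans (+-congˡ (∑ₗ-swap h xs ys)) (sym (∑ₗ-+ (h x) _ ys))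

module MonomialValue {c ℓ} (F : Field c ℓ) where
  open Field F hiding (zero)
  open Exp semiring using (_^_; ^-homo-*)
  open CommutativeSemigroupProperties *-commutativeSemigroup using (interchange)
  open import Relation.Binary.Reasoning.Setoid setoid

  monomialValue : ∀ {k} → (Fin k → Carrier) → Vec ℕ k → Carrier
  monomialValue v []      = 1#
  monomialValue v (e ∷ ν) = v zero ^ e * monomialValue (v ∘ suc) ν

  monomialValue-+ : ∀ {k} (v : Fin k → Carrier) ν ν′ →
                    monomialValue v (zipWith ℕ._+_ ν ν′) ≈ monomialValue v ν * monomialValue v ν′
  monomialValue-+ v []      []        = sym (*-identityˡ 1#)
  monomialValue-+ v (e ∷ ν) (e′ ∷ ν′) =
    trans (*-cong (^-homo-* (v zero) e e′) (monomialValue-+ (v ∘ suc) ν ν′)) (interchange _ _ _ _)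

  monomialValue-0 : ∀ {k} (v : Fin k → Carrier) → monomialValue v (replicate k 0) ≈ 1#
  monomialValue-0 {zero}  v = refl
  monomialValue-0 {suc k} v = trans (*-identityˡ _) (monomialValue-0 (v ∘ suc))

  monomialValue-unit : ∀ {k} (v : Fin k → Carrier) i →
                       monomialValue v (tabulate (λ j → if does (j ≟ᶠ i) then 1 else 0)) ≈ v i
  monomialValue-unit {suc k} v zero    = begin
    v zero ^ 1 * monomialValue (v ∘ suc) (tabulate (λ _ → 0))
      ≡⟨ ≡.cong (λ ν → v zero ^ 1 * monomialValue (v ∘ suc) ν) (tabulate-const k 0) ⟩
    v zero ^ 1 * monomialValue (v ∘ suc) (replicate k 0)
      ≈⟨ *-cong (*-identityʳ _) (monomialValue-0 (v ∘ suc)) ⟩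
    v zero * 1#
      ≈⟨ *-identityʳ _ ⟩
    v zero
      ∎
  monomialValue-unit {suc k} v (suc i) = trans (*-identityˡ _) (monomialValue-unit (v ∘ suc) i)

module PolynomialFunctionals {c ℓ} (F : Field c ℓ) (m : ℕ) where
  open Field F hiding (zero)
  open Poly F m
  open MonomialValue F
  open ListSum semiring
  open import Relation.Binary.Reasoning.Setoid setoid
  open CommutativeSemigroupProperties *-commutativeSemigroup using (x∙yz≈y∙xz)
  open RingProperties ring using (-1*x≈-x; -‿involutive; ⁻¹-anti-homo‿-)

  weigh : (Monomial → Carrier) → Polynomial → Carrier
  weigh w = ∑ₗ (λ (a , ν) → a * w ν)

  -- Agreement under every linear functional.  Unlike _≈ₚ_, this turns the
  -- monoid laws of _*ₚ_ into rearrangements of finite sums.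
  infix 4 _≃_
  record _≃_ (p q : Polynomial) : Set (c ⊔ ℓ) where
    constructor mk≃
    field weigh-≈ : ∀ w → weigh w p ≈ weigh w q
  open _≃_ public

  infixl 6 _⊕_
  _⊕_ : Monomial → Monomial → Monomial
  _⊕_ = zipWith ℕ._+_

  weigh-cong : ∀ {w w′} p → (∀ ν → w ν ≈ w′ ν) → weigh w p ≈ weigh w′ p
  weigh-cong p w≈w′ = ∑ₗ-cong p (λ (a , ν) → *-congˡ (w≈w′ ν))

  weigh-*ₚ-expand : ∀ w p q →
    weigh w (p *ₚ q) ≈ ∑ₗ (λ (a , ν) → ∑ₗ (λ (b , ν′) → (a * b) * w (ν ⊕ ν′)) q) p
  weigh-*ₚ-expand w p q =
    trans (∑ₗ-concatMap _ _ p) (∑ₗ-cong p (λ _ → reflexive (∑ₗ-map _ _ q)))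

  weigh-*ₚ : ∀ w p q → weigh w (p *ₚ q) ≈ weigh (λ ν → weigh (λ ν′ → w (ν ⊕ ν′)) q) p
  weigh-*ₚ w p q = trans (weigh-*ₚ-expand w p q) (∑ₗ-cong p λ (a , ν) →
    trans (∑ₗ-cong q (λ _ → *-assoc _ _ _)) (∑ₗ-*ˡ a _ q))

  constant : Carrier → Polynomial
  constant a = (a , replicate m 0) ∷ []

  weigh-constant-*ₚ : ∀ w a q → weigh w (constant a *ₚ q) ≈ a * weigh w q
  weigh-constant-*ₚ w a q = begin
    weigh w (constant a *ₚ q)                       ≈⟨ weigh-*ₚ w (constant a) q ⟩
    a * weigh (λ ν → w (replicate m 0 ⊕ ν)) q + 0#  ≈⟨ +-identityʳ _ ⟩
    a * weigh (λ ν → w (replicate m 0 ⊕ ν)) q       ≈⟨ *-congˡ (weigh-cong q λ ν → reflexive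
                                                          (≡.cong w (zipWith-identityˡ ℕ.+-identityˡ ν))) ⟩
    a * weigh w q                                   ∎

  ≃-isEquivalence : IsEquivalence _≃_
  ≃-isEquivalence = record
    { refl  = mk≃ λ w → refl
    ; sym   = λ p≃q → mk≃ λ w → sym (weigh-≈ p≃q w)
    ; trans = λ p≃q q≃r → mk≃ λ w → trans (weigh-≈ p≃q w) (weigh-≈ q≃r w)
    }

  *ₚ-cong : ∀ {p p′ q q′} → p ≃ p′ → q ≃ q′ → p *ₚ q ≃ p′ *ₚ q′
  *ₚ-cong {p} {p′} {q} {q′} p≃p′ q≃q′ = mk≃ λ w → begin
    weigh w (p *ₚ q)                                ≈⟨ weigh-*ₚ w p q ⟩
    weigh (λ ν → weigh (λ ν′ → w (ν ⊕ ν′)) q) p     ≈⟨ weigh-cong p (λ ν → weigh-≈ q≃q′ _) ⟩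
    weigh (λ ν → weigh (λ ν′ → w (ν ⊕ ν′)) q′) p    ≈⟨ weigh-≈ p≃p′ _ ⟩
    weigh (λ ν → weigh (λ ν′ → w (ν ⊕ ν′)) q′) p′   ≈⟨ weigh-*ₚ w p′ q′ ⟨
    weigh w (p′ *ₚ q′)                              ∎

  *ₚ-assoc : ∀ p q r → (p *ₚ q) *ₚ r ≃ p *ₚ (q *ₚ r)
  *ₚ-assoc p q r = mk≃ λ w → begin
    weigh w ((p *ₚ q) *ₚ r)
      ≈⟨ weigh-*ₚ w (p *ₚ q) r ⟩
    weigh (λ ν → weigh (λ ν′ → w (ν ⊕ ν′)) r) (p *ₚ q)
      ≈⟨ weigh-*ₚ _ p q ⟩
    weigh (λ ν₁ → weigh (λ ν₂ → weigh (λ ν₃ → w ((ν₁ ⊕ ν₂) ⊕ ν₃)) r) q) p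
      ≈⟨ weigh-cong p (λ ν₁ → weigh-cong q λ ν₂ → weigh-cong r λ ν₃ →
           reflexive (≡.cong w (zipWith-assoc ℕ.+-assoc ν₁ ν₂ ν₃))) ⟩
    weigh (λ ν₁ → weigh (λ ν₂ → weigh (λ ν₃ → w (ν₁ ⊕ (ν₂ ⊕ ν₃))) r) q) p
      ≈⟨ weigh-cong p (λ ν₁ → weigh-*ₚ _ q r) ⟨
    weigh (λ ν → weigh (λ ν′ → w (ν ⊕ ν′)) (q *ₚ r)) p
      ≈⟨ weigh-*ₚ w p (q *ₚ r) ⟨
    weigh w (p *ₚ (q *ₚ r))
      ∎

  *ₚ-comm : ∀ p q → p *ₚ q ≃ q *ₚ p
  *ₚ-comm p q = mk≃ λ w → begin
    weigh w (p *ₚ q)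
      ≈⟨ weigh-*ₚ-expand w p q ⟩
    ∑ₗ (λ (a , ν) → ∑ₗ (λ (b , ν′) → (a * b) * w (ν ⊕ ν′)) q) p
      ≈⟨ ∑ₗ-swap _ p q ⟩
    ∑ₗ (λ (b , ν′) → ∑ₗ (λ (a , ν) → (a * b) * w (ν ⊕ ν′)) p) q
      ≈⟨ ∑ₗ-cong q (λ (b , ν′) → ∑ₗ-cong p λ (a , ν) →
           *-cong (*-comm a b) (reflexive (≡.cong w (zipWith-comm ℕ.+-comm ν ν′)))) ⟩
    ∑ₗ (λ (b , ν′) → ∑ₗ (λ (a , ν) → (b * a) * w (ν′ ⊕ ν)) p) q
      ≈⟨ weigh-*ₚ-expand w q p ⟨
    weigh w (q *ₚ p)
      ∎

  *ₚ-identityˡ : ∀ p → oneₚ *ₚ p ≃ p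
  *ₚ-identityˡ p = mk≃ λ w → trans (weigh-constant-*ₚ w 1# p) (*-identityˡ _)

  *ₚ-isCommutativeMonoid : IsCommutativeMonoid _≃_ _*ₚ_ oneₚ
  *ₚ-isCommutativeMonoid = record
    { isMonoid = record
      { isSemigroup = record
        { isMagma = record { isEquivalence = ≃-isEquivalence ; ∙-cong = *ₚ-cong }
        ; assoc   = *ₚ-assoc
        }
      ; identity = *ₚ-identityˡ
                 , λ p → mk≃ λ w → trans (weigh-≈ (*ₚ-comm p oneₚ) w) (weigh-≈ (*ₚ-identityˡ p) w)
      }
    ; comm = *ₚ-comm
    }

  *ₚ-commutativeMonoid : CommutativeMonoid c (c ⊔ ℓ)
  *ₚ-commutativeMonoid = record { isCommutativeMonoid = *ₚ-isCommutativeMonoid }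

  _≟ᵥ_ : (μ ν : Monomial) → Dec (μ ≡ ν)
  _≟ᵥ_ = ≡-dec ℕ._≟_

  termCoeff : Monomial → Carrier → Monomial → Carrier
  termCoeff ν a μ = if does (ν ≟ᵥ μ) then a else 0#

  indicator : Monomial → Monomial → Carrier
  indicator μ ν = termCoeff ν 1# μ

  coeff≈weigh-indicator : ∀ p μ → coeff p μ ≈ weigh (indicator μ) p
  coeff≈weigh-indicator []            μ = refl
  coeff≈weigh-indicator ((a , ν) ∷ p) μ with does (ν ≟ᵥ μ)
  ... | true  = +-cong (sym (*-identityʳ a)) (coeff≈weigh-indicator p μ)
  ... | false = trans (coeff≈weigh-indicator p μ) (sym (trans (+-congʳ (zeroʳ a)) (+-identityˡ _)))

  ≃⇒≈ₚ : ∀ {p q} → p ≃ q → p ≈ₚ q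
  ≃⇒≈ₚ {p} {q} p≃q μ =
    trans (coeff≈weigh-indicator p μ) (trans (weigh-≈ p≃q (indicator μ)) (sym (coeff≈weigh-indicator q μ)))

  ∑ₗ-termCoeff-∉ : ∀ ν a (w : Monomial → Carrier) L → ν ∉ L → ∑ₗ (λ μ → termCoeff ν a μ * w μ) L ≈ 0#
  ∑ₗ-termCoeff-∉ ν a w []      ν∉L = refl
  ∑ₗ-termCoeff-∉ ν a w (μ ∷ L) ν∉L with ν ≟ᵥ μ
  ... | yes ν≡μ = ⊥-elim (ν∉L (here ν≡μ))
  ... | no  _   = trans (+-cong (zeroˡ _) (∑ₗ-termCoeff-∉ ν a w L (ν∉L ∘ there))) (+-identityˡ _)

  ∑ₗ-termCoeff : ∀ ν a (w : Monomial → Carrier) L → Unique L → ν ∈ L →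
              ∑ₗ (λ μ → termCoeff ν a μ * w μ) L ≈ a * w ν
  ∑ₗ-termCoeff ν a w (μ ∷ L) (μ∉L ∷ L!) ν∈μ∷L with ν ≟ᵥ μ | ν∈μ∷L
  ... | yes ≡.refl | _        = trans (+-congˡ (∑ₗ-termCoeff-∉ ν a w L (All¬⇒¬Any μ∉L))) (+-identityʳ _)
  ... | no  ν≢μ    | here ν≡μ = ⊥-elim (ν≢μ ν≡μ)
  ... | no  _      | there ν∈L = trans (+-cong (zeroˡ _) (∑ₗ-termCoeff ν a w L L! ν∈L)) (+-identityˡ _)

  weigh≈∑ₗ-coeff : ∀ w p L → Unique L → (∀ {ν} → ν ∈ map proj₂ p → ν ∈ L) →
                   weigh w p ≈ ∑ₗ (λ μ → coeff p μ * w μ) L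
  weigh≈∑ₗ-coeff w []            L L! p⊆L = sym (trans (∑ₗ-cong L (λ μ → zeroˡ _)) (∑ₗ-zero L))
  weigh≈∑ₗ-coeff w ((a , ν) ∷ p) L L! p⊆L = begin
    a * w ν + weigh w p
      ≈⟨ +-cong (sym (∑ₗ-termCoeff ν a w L L! (p⊆L (here ≡.refl)))) (weigh≈∑ₗ-coeff w p L L! (p⊆L ∘ there)) ⟩
    ∑ₗ (λ μ → termCoeff ν a μ * w μ) L + ∑ₗ (λ μ → coeff p μ * w μ) L
      ≈⟨ ∑ₗ-+ _ _ L ⟨
    ∑ₗ (λ μ → termCoeff ν a μ * w μ + coeff p μ * w μ) L
      ≈⟨ ∑ₗ-cong L merge ⟩
    ∑ₗ (λ μ → coeff ((a , ν) ∷ p) μ * w μ) L ∎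
    where
    merge : ∀ μ → termCoeff ν a μ * w μ + coeff p μ * w μ ≈ coeff ((a , ν) ∷ p) μ * w μ
    merge μ with does (ν ≟ᵥ μ)
    ... | true  = sym (distribʳ _ _ _)
    ... | false = trans (+-congʳ (zeroˡ _)) (+-identityˡ _)

  ≈ₚ⇒≃ : ∀ {p q} → p ≈ₚ q → p ≃ q
  ≈ₚ⇒≃ {p} {q} p≈q = mk≃ λ w → begin
    weigh w p                        ≈⟨ weigh≈∑ₗ-coeff w p L L! (∈-deduplicate⁺ _≟ᵥ_ ∘ ∈-++⁺ˡ) ⟩
    ∑ₗ (λ μ → coeff p μ * w μ) L     ≈⟨ ∑ₗ-cong L (λ μ → *-congʳ (p≈q μ)) ⟩
    ∑ₗ (λ μ → coeff q μ * w μ) L     ≈⟨ weigh≈∑ₗ-coeff w q L L! (∈-deduplicate⁺ _≟ᵥ_ ∘ ∈-++⁺ʳ (map proj₂ p)) ⟨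
    weigh w q                        ∎
    where
    L  = deduplicate _≟ᵥ_ (map proj₂ p ++ map proj₂ q)
    L! = deduplicate-! _≟ᵥ_ (map proj₂ p ++ map proj₂ q)

  weigh-scaleˡ : ∀ k w p → weigh (λ ν → k * w ν) p ≈ k * weigh w p
  weigh-scaleˡ k w p = trans (∑ₗ-cong p (λ (a , ν) → x∙yz≈y∙xz a k (w ν))) (∑ₗ-*ˡ k _ p)

  weigh-constant : ∀ w a → weigh w (constant a) ≈ a * w (replicate m 0)
  weigh-constant w a = +-identityʳ _

  weigh-diffVar : ∀ w i j → weigh w (diffVar i j) ≈ w (unit i) - w (unit j)
  weigh-diffVar w i j = +-cong (*-identityˡ _) (trans (+-identityʳ _) (-1*x≈-x _))

  diffVar-antisym : ∀ i j → diffVar j i ≃ constant (- 1#) *ₚ diffVar i j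
  diffVar-antisym i j = mk≃ λ w → begin
    weigh w (diffVar j i)                        ≈⟨ weigh-diffVar w j i ⟩
    w (unit j) - w (unit i)                      ≈⟨ ⁻¹-anti-homo‿- _ _ ⟨
    - (w (unit i) - w (unit j))                  ≈⟨ -1*x≈-x _ ⟨
    - 1# * (w (unit i) - w (unit j))             ≈⟨ *-congˡ (weigh-diffVar w i j) ⟨
    - 1# * weigh w (diffVar i j)                 ≈⟨ weigh-constant-*ₚ w (- 1#) (diffVar i j) ⟨
    weigh w (constant (- 1#) *ₚ diffVar i j)     ∎

  constant-[-1]² : constant (- 1#) *ₚ constant (- 1#) ≃ oneₚ
  constant-[-1]² = mk≃ λ w → begin
    weigh w (constant (- 1#) *ₚ constant (- 1#))  ≈⟨ weigh-constant-*ₚ w (- 1#) (constant (- 1#)) ⟩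
    - 1# * weigh w (constant (- 1#))              ≈⟨ *-congˡ (weigh-constant w (- 1#)) ⟩
    - 1# * (- 1# * w (replicate m 0))             ≈⟨ trans (-1*x≈-x _) (-‿cong (-1*x≈-x _)) ⟩
    - - w (replicate m 0)                         ≈⟨ -‿involutive _ ⟩
    w (replicate m 0)                             ≈⟨ trans (weigh-constant w 1#) (*-identityˡ _) ⟨
    weigh w oneₚ                                  ∎

  eval : (Fin m → Carrier) → Polynomial → Carrier
  eval v = weigh (monomialValue v)

  eval-*ₚ : ∀ v p q → eval v (p *ₚ q) ≈ eval v p * eval v q
  eval-*ₚ v p q = begin
    eval v (p *ₚ q)                                               ≈⟨ weigh-*ₚ _ p q ⟩
    weigh (λ ν → weigh (λ ν′ → monomialValue v (ν ⊕ ν′)) q) p    ≈⟨ weigh-cong p (λ ν →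
                                                                       trans (weigh-cong q (monomialValue-+ v ν))
                                                                             (weigh-scaleˡ _ _ q)) ⟩
    weigh (λ ν → monomialValue v ν * eval v q) p                  ≈⟨ weigh-cong p (λ ν → *-comm _ _) ⟩
    weigh (λ ν → eval v q * monomialValue v ν) p                  ≈⟨ weigh-scaleˡ _ _ p ⟩
    eval v q * eval v p                                           ≈⟨ *-comm _ _ ⟩
    eval v p * eval v q                                           ∎

  eval-oneₚ : ∀ v → eval v oneₚ ≈ 1#
  eval-oneₚ v = trans (weigh-constant (monomialValue v) 1#) (trans (*-identityˡ _) (monomialValue-0 v))

  eval-diffVar : ∀ v i j → eval v (diffVar i j) ≈ v i - v j
  eval-diffVar v i j = trans (weigh-diffVar (monomialValue v) i j)
                             (+-cong (monomialValue-unit v i) (-‿cong (monomialValue-unit v j)))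

  eval-cong : ∀ v {p q} → p ≃ q → eval v p ≈ eval v q
  eval-cong v p≃q = weigh-≈ p≃q (monomialValue v)

module FieldProperties {c ℓ} (F : Field c ℓ) where
  open Field F hiding (zero)
  open RawMonoidDefinitions *-rawMonoid using () renaming (sum to product)
  open RingProperties ring using (-0#≈0#; -‿involutive; x∙y⁻¹≈ε⇒x≈y)
  open import Relation.Binary.Reasoning.Setoid setoid

  *-nonzero : ∀ {x y} → ¬ x ≈ 0# → ¬ y ≈ 0# → ¬ x * y ≈ 0#
  *-nonzero {x} {y} x≉0 y≉0 xy≈0 with inverse x x≉0
  ... | x⁻¹ , xx⁻¹≈1 = y≉0 (begin
    y                ≈⟨ *-identityˡ y ⟨
    1# * y           ≈⟨ *-congʳ (trans (sym xx⁻¹≈1) (*-comm x x⁻¹)) ⟩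
    (x⁻¹ * x) * y    ≈⟨ *-assoc x⁻¹ x y ⟩
    x⁻¹ * (x * y)    ≈⟨ *-congˡ xy≈0 ⟩
    x⁻¹ * 0#         ≈⟨ zeroʳ x⁻¹ ⟩
    0#               ∎)

  product-nonzero : ∀ {n} (f : Vector Carrier n) → (∀ i → ¬ f i ≈ 0#) → ¬ product f ≈ 0#
  product-nonzero {zero}  f f≉0 = 1≉0
  product-nonzero {suc n} f f≉0 = *-nonzero (f≉0 zero) (product-nonzero (f ∘ suc) (f≉0 ∘ suc))

  product-zero : ∀ {n} (f : Vector Carrier n) i → f i ≈ 0# → product f ≈ 0#
  product-zero f zero    fi≈0 = trans (*-congʳ fi≈0) (zeroˡ _)
  product-zero f (suc i) fi≈0 = trans (*-congˡ (product-zero (f ∘ suc) i fi≈0)) (zeroʳ _)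

  -‿nonzero : ∀ {x} → ¬ x ≈ 0# → ¬ - x ≈ 0#
  -‿nonzero x≉0 -x≈0 = x≉0 (trans (sym (-‿involutive _)) (trans (-‿cong -x≈0) -0#≈0#))

  colourValue : Maybe Parity → Carrier
  colourValue nothing   = 0#
  colourValue (just 0ℙ) = 1#
  colourValue (just 1ℙ) = - 1#

  colourValue-injective : CharNot2 F → ∀ p q → colourValue p ≈ colourValue q → p ≡ q
  colourValue-injective ch2 nothing   nothing   _ = ≡.refl
  colourValue-injective ch2 (just 0ℙ) (just 0ℙ) _ = ≡.refl
  colourValue-injective ch2 (just 1ℙ) (just 1ℙ) _ = ≡.refl
  colourValue-injective ch2 nothing   (just 0ℙ) 0≈1  = ⊥-elim (1≉0 (sym 0≈1))
  colourValue-injective ch2 nothing   (just 1ℙ) 0≈-1 = ⊥-elim (-‿nonzero 1≉0 (sym 0≈-1))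
  colourValue-injective ch2 (just 0ℙ) nothing   1≈0  = ⊥-elim (1≉0 1≈0)
  colourValue-injective ch2 (just 1ℙ) nothing   -1≈0 = ⊥-elim (-‿nonzero 1≉0 -1≈0)
  colourValue-injective ch2 (just 0ℙ) (just 1ℙ) 1≈-1 = ⊥-elim (ch2 (trans (+-congˡ 1≈-1) (-‿inverseʳ 1#)))
  colourValue-injective ch2 (just 1ℙ) (just 0ℙ) -1≈1 = ⊥-elim (ch2 (trans (+-congˡ (sym -1≈1)) (-‿inverseʳ 1#)))

  difference-nonzero : ∀ {x y} → ¬ x ≈ y → ¬ x - y ≈ 0#
  difference-nonzero x≉y x-y≈0 = x≉y (x∙y⁻¹≈ε⇒x≈y _ _ x-y≈0)

module Cycle (m′ : ℕ) where
  open ≡ using (refl; sym; trans; cong; subst)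
  open ≡.≡-Reasoning
  open import Data.Nat using (_+_; _∸_; _%_; _<_; s≤s; z≤n)

  m : ℕ
  m = suc m′

  r s : Fin m → Fin m
  r = rot m
  s = refl′ m

  private
    toℕ%m : ∀ (i : Fin m) → toℕ i % m ≡ toℕ i
    toℕ%m i = m<n⇒m%n≡m (toℕ<n i)

    inner-or-last : ∀ (i : Fin m) → suc (toℕ i) < m ⊎ suc (toℕ i) ≡ m
    inner-or-last i = ℕ.m≤n⇒m<n∨m≡n (toℕ<n i)

    m∸suc<m : ∀ t → m ∸ suc t < m
    m∸suc<m t = s≤s (ℕ.m∸n≤m m′ t)

  toℕ-r : ∀ i → toℕ (r i) ≡ suc (toℕ i) % m
  toℕ-r i = toℕ-fromℕ< _

  toℕ-r-< : ∀ {i} → suc (toℕ i) < m → toℕ (r i) ≡ suc (toℕ i)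
  toℕ-r-< lt = trans (toℕ-r _) (m<n⇒m%n≡m lt)

  toℕ-r-last : ∀ {i} → suc (toℕ i) ≡ m → toℕ (r i) ≡ 0
  toℕ-r-last {i} eq = trans (toℕ-r i) (trans (cong (_% m) eq) (n%n≡0 m))

  toℕ-s : ∀ i → toℕ (s i) ≡ (m ∸ toℕ i) % m
  toℕ-s i = toℕ-fromℕ< _

  toℕ-s-suc : ∀ j → toℕ (s (suc j)) ≡ m ∸ suc (toℕ j)
  toℕ-s-suc j = trans (toℕ-s (suc j)) (m<n⇒m%n≡m (m∸suc<m (toℕ j)))

  toℕ-s-zero : toℕ (s zero) ≡ 0
  toℕ-s-zero = trans (toℕ-s zero) (n%n≡0 m)

  s-involutive : ∀ i → s (s i) ≡ i
  s-involutive zero = toℕ-injective (begin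
    toℕ (s (s zero))       ≡⟨ toℕ-s (s zero) ⟩
    (m ∸ toℕ (s zero)) % m ≡⟨ cong (λ t → (m ∸ t) % m) toℕ-s-zero ⟩
    m % m                  ≡⟨ n%n≡0 m ⟩
    0                      ∎)
  s-involutive (suc j) = toℕ-injective (begin
    toℕ (s (s (suc j)))             ≡⟨ toℕ-s (s (suc j)) ⟩
    (m ∸ toℕ (s (suc j))) % m       ≡⟨ cong (λ t → (m ∸ t) % m) (toℕ-s-suc j) ⟩
    (m ∸ (m ∸ suc (toℕ j))) % m     ≡⟨ cong (_% m) (ℕ.m∸[m∸n]≡n (ℕ.<⇒≤ (toℕ<n (suc j)))) ⟩
    suc (toℕ j) % m                 ≡⟨ toℕ%m (suc j) ⟩
    suc (toℕ j)                     ∎)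

  r-s-r : ∀ i → r (s (r i)) ≡ s i
  r-s-r i with inner-or-last i
  ... | inj₁ lt = toℕ-injective (begin
    toℕ (r (s (r i)))                ≡⟨ toℕ-r (s (r i)) ⟩
    suc (toℕ (s (r i))) % m          ≡⟨ cong (λ t → suc t % m) (toℕ-s (r i)) ⟩
    suc ((m ∸ toℕ (r i)) % m) % m    ≡⟨ cong (λ t → suc ((m ∸ t) % m) % m) (toℕ-r-< lt) ⟩
    suc ((m ∸ suc (toℕ i)) % m) % m  ≡⟨ cong (λ t → suc t % m) (m<n⇒m%n≡m (m∸suc<m (toℕ i))) ⟩
    suc (m ∸ suc (toℕ i)) % m        ≡⟨ cong (_% m) (ℕ.+-∸-assoc 1 (ℕ.<⇒≤ lt)) ⟨
    (m ∸ toℕ i) % m                  ≡⟨ toℕ-s i ⟨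
    toℕ (s i)                        ∎)
  ... | inj₂ eq = toℕ-injective (begin
    toℕ (r (s (r i)))                ≡⟨ toℕ-r (s (r i)) ⟩
    suc (toℕ (s (r i))) % m          ≡⟨ cong (λ t → suc t % m) (toℕ-s (r i)) ⟩
    suc ((m ∸ toℕ (r i)) % m) % m    ≡⟨ cong (λ t → suc ((m ∸ t) % m) % m) (toℕ-r-last eq) ⟩
    suc (m % m) % m                  ≡⟨ cong (λ t → suc t % m) (n%n≡0 m) ⟩
    1 % m                            ≡⟨ cong (_% m) (trans (cong (_∸ toℕ i) (sym eq)) (ℕ.m+n∸n≡m 1 (toℕ i))) ⟨
    (m ∸ toℕ i) % m                  ≡⟨ toℕ-s i ⟨
    toℕ (s i)                        ∎)

  -- r⁻¹ = s r s
  rotation : Permutation′ m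
  rotation = permutation r (s ∘ r ∘ s)
    (λ i → trans (r-s-r (s i)) (s-involutive i))
    (λ i → trans (cong s (r-s-r i)) (s-involutive i))

  reflection : Permutation′ m
  reflection = permutation s s s-involutive s-involutive

  perm-injective : ∀ (σ : Permutation′ m) {i j} → σ ⟨$⟩ʳ i ≡ σ ⟨$⟩ʳ j → i ≡ j
  perm-injective σ {i} {j} σi≡σj = begin
    i                    ≡⟨ Perm.inverseˡ σ ⟨
    σ ⟨$⟩ˡ (σ ⟨$⟩ʳ i)    ≡⟨ cong (σ ⟨$⟩ˡ_) σi≡σj ⟩
    σ ⟨$⟩ˡ (σ ⟨$⟩ʳ j)    ≡⟨ Perm.inverseˡ σ ⟩
    j                    ∎

  toℕ-r-r : ∀ i → toℕ (r (r i)) ≡ (2 + toℕ i) % m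
  toℕ-r-r i = begin
    toℕ (r (r i))              ≡⟨ toℕ-r (r i) ⟩
    suc (toℕ (r i)) % m        ≡⟨ cong (λ t → suc t % m) (toℕ-r i) ⟩
    (1 + suc (toℕ i) % m) % m  ≡⟨ %-distribˡ-+ 1 (suc (toℕ i) % m) m ⟩
    (1 % m + suc (toℕ i) % m % m) % m ≡⟨ cong (λ t → (1 % m + t) % m) (m%n%n≡m%n (suc (toℕ i)) m) ⟩
    (1 % m + suc (toℕ i) % m) % m ≡⟨ %-distribˡ-+ 1 (suc (toℕ i)) m ⟨
    (2 + toℕ i) % m            ∎

  r-irreflexive : 1 < m → ∀ i → r i ≢ i
  r-irreflexive 1<m i ri≡i with inner-or-last i
  ... | inj₁ lt = ℕ.1+n≢n (trans (sym (toℕ-r-< lt)) (cong toℕ ri≡i))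
  ... | inj₂ eq = ℕ.<-irrefl (sym (trans (sym eq) (cong suc i≡0))) 1<m
    where
    i≡0 : toℕ i ≡ 0
    i≡0 = trans (sym (cong toℕ ri≡i)) (toℕ-r-last eq)

  r-r-irreflexive : 2 < m → ∀ i → r (r i) ≢ i
  r-r-irreflexive 2<m i rri≡i with inner-or-last i
  ... | inj₂ eq = ℕ.<-irrefl (sym (trans (sym eq) (cong suc i≡1))) 2<m
    where
    i≡1 : toℕ i ≡ 1
    i≡1 = begin
      toℕ i             ≡⟨ cong toℕ rri≡i ⟨
      toℕ (r (r i))     ≡⟨ toℕ-r (r i) ⟩
      suc (toℕ (r i)) % m ≡⟨ cong (λ t → suc t % m) (toℕ-r-last eq) ⟩
      1 % m             ≡⟨ m<n⇒m%n≡m (ℕ.<-trans (s≤s (s≤s z≤n)) 2<m) ⟩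
      1                 ∎
  ... | inj₁ lt with inner-or-last (r i)
  ...   | inj₁ lt′ = ℕ.m≢1+n+m (toℕ i) {1} (sym (begin
      2 + toℕ i         ≡⟨ cong suc (toℕ-r-< lt) ⟨
      suc (toℕ (r i))   ≡⟨ toℕ-r-< lt′ ⟨
      toℕ (r (r i))     ≡⟨ cong toℕ rri≡i ⟩
      toℕ i             ∎))
  ...   | inj₂ eq′ = ℕ.<-irrefl (sym (trans (sym eq′) (cong suc (trans (toℕ-r-< lt) (cong suc i≡0))))) 2<m
    where
    i≡0 : toℕ i ≡ 0
    i≡0 = trans (sym (cong toℕ rri≡i)) (toℕ-r-last eq′)

  r-r-involutive : m ≡ 2 → ∀ i → r (r i) ≡ i
  r-r-involutive m≡2 i = toℕ-injective (begin
    toℕ (r (r i))      ≡⟨ toℕ-r-r i ⟩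
    (2 + toℕ i) % m    ≡⟨ cong (_% m) (trans (ℕ.+-comm 2 (toℕ i)) (cong (toℕ i +_) (sym m≡2))) ⟩
    (toℕ i + m) % m    ≡⟨ [m+n]%n≡m%n (toℕ i) m ⟩
    toℕ i % m          ≡⟨ toℕ%m i ⟩
    toℕ i              ∎)

  r-fromℕ< : ∀ {k} (k+1<m : suc k < m) → r (fromℕ< (ℕ.<-trans (ℕ.n<1+n k) k+1<m)) ≡ fromℕ< k+1<m
  r-fromℕ< {k} k+1<m = toℕ-injective (begin
    toℕ (r (fromℕ< _))       ≡⟨ toℕ-r _ ⟩
    suc (toℕ (fromℕ< _)) % m ≡⟨ cong (λ t → suc t % m) (toℕ-fromℕ< _) ⟩
    suc k % m                ≡⟨ m<n⇒m%n≡m k+1<m ⟩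
    suc k                    ≡⟨ toℕ-fromℕ< k+1<m ⟨
    toℕ (fromℕ< k+1<m)       ∎)

  r-induction : ∀ {p} (P : Fin m → Set p) → P zero → (∀ i → P i → P (r i)) → ∀ i → P i
  r-induction P P0 Pr i = subst P (fromℕ<-toℕ i (toℕ<n i)) (go (toℕ i) (toℕ<n i))
    where
    go : ∀ k (k<m : k < m) → P (fromℕ< k<m)
    go zero    _     = P0
    go (suc k) k+1<m = subst P (r-fromℕ< k+1<m) (Pr _ (go k (ℕ.<-trans (ℕ.n<1+n k) k+1<m)))

  rotPow : ℕ → Permutation′ m
  rotPow zero    = Perm.id
  rotPow (suc a) = rotPow a ∘ₚ rotation

  rotPow-commutes : ∀ a i → rotPow a ⟨$⟩ʳ r i ≡ r (rotPow a ⟨$⟩ʳ i)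
  rotPow-commutes zero    i = refl
  rotPow-commutes (suc a) i = cong r (rotPow-commutes a i)

  rotPow-reaches : ∀ j → ∃ λ a → rotPow a ⟨$⟩ʳ zero ≡ j
  rotPow-reaches = r-induction _ (0 , refl) (λ { j (a , eq) → suc a , cong r eq })

  Equivariant : (Fin m → Fin m) → Set
  Equivariant f = ∀ i → f (r i) ≡ r (f i)

  equivariant-unique : ∀ {f g} → Equivariant f → Equivariant g → f zero ≡ g zero → ∀ i → f i ≡ g i
  equivariant-unique {f} {g} f-eq g-eq f0≡g0 =
    r-induction (λ i → f i ≡ g i) f0≡g0 (λ i fi≡gi → trans (f-eq i) (trans (cong r fi≡gi) (sym (g-eq i))))

  equivariant⇒rotPow : ∀ {f} → Equivariant f → ∃ λ a → ∀ i → f i ≡ rotPow a ⟨$⟩ʳ i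
  equivariant⇒rotPow {f} f-eq with rotPow-reaches (f zero)
  ... | a , eq = a , equivariant-unique f-eq (rotPow-commutes a) (sym eq)

  dihedral-resp : ∀ {σ τ} → (∀ i → σ ⟨$⟩ʳ i ≡ τ ⟨$⟩ʳ i) → InDihedral m τ → InDihedral m σ
  dihedral-resp {σ} {τ} σ≗τ τ∈D = gen-comp σ τ Perm.id τ∈D (gen-id Perm.id (λ _ → refl)) σ≗τ

  rotPow-dihedral : ∀ a → InDihedral m (rotPow a)
  rotPow-dihedral zero    = gen-id _ (λ _ → refl)
  rotPow-dihedral (suc a) =
    gen-comp _ rotation (rotPow a) (gen-rot rotation (λ _ → refl)) (rotPow-dihedral a) (λ _ → refl)

  Forward Backward : Permutation′ m → Fin m → Set
  Forward  σ i = σ ⟨$⟩ʳ r i ≡ r (σ ⟨$⟩ʳ i)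
  Backward σ i = r (σ ⟨$⟩ʳ r i) ≡ σ ⟨$⟩ʳ i

  forward⇒dihedral : ∀ σ → (∀ i → Forward σ i) → InDihedral m σ
  forward⇒dihedral σ fwd with equivariant⇒rotPow fwd
  ... | a , σ≗rᵃ = dihedral-resp σ≗rᵃ (rotPow-dihedral a)

  backward⇒equivariant∘s : ∀ σ → (∀ i → Backward σ i) → Equivariant ((σ ⟨$⟩ʳ_) ∘ s)
  backward⇒equivariant∘s σ bwd i = trans (sym (bwd (s (r i)))) (cong (λ j → r (σ ⟨$⟩ʳ j)) (r-s-r i))

  backward⇒dihedral : ∀ σ → (∀ i → Backward σ i) → InDihedral m σ
  backward⇒dihedral σ bwd with equivariant⇒rotPow (backward⇒equivariant∘s σ bwd)
  ... | a , σs≗rᵃ = gen-comp σ (rotPow a) reflection (rotPow-dihedral a) (gen-refl reflection (λ _ → refl))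
                      (λ i → trans (cong (σ ⟨$⟩ʳ_) (sym (s-involutive i))) (σs≗rᵃ (s i)))

  locally-dihedral⇒dihedral : 1 < m → ∀ σ → (∀ i → Forward σ i ⊎ Backward σ i) → InDihedral m σ
  locally-dihedral⇒dihedral 1<m σ local with ℕ.m≤n⇒m<n∨m≡n 1<m
  ... | inj₂ 2≡m = forward⇒dihedral σ (λ i → forward (local i))
    where
    forward : ∀ {i} → Forward σ i ⊎ Backward σ i → Forward σ i
    forward (inj₁ fwd) = fwd
    forward (inj₂ bwd) = trans (sym (r-r-involutive (sym 2≡m) _)) (cong r bwd)
  ... | inj₁ 2<m with local zero
  ...   | inj₁ fwd₀ = forward⇒dihedral σ (r-induction (Forward σ) fwd₀ step)
    where
    step : ∀ i → Forward σ i → Forward σ (r i)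
    step i fwd with local (r i)
    ... | inj₁ fwd′ = fwd′
    ... | inj₂ bwd′ = ⊥-elim (r-r-irreflexive 2<m i
                        (perm-injective σ (perm-injective rotation (trans bwd′ fwd))))
  ...   | inj₂ bwd₀ = backward⇒dihedral σ (r-induction (Backward σ) bwd₀ step)
    where
    step : ∀ i → Backward σ i → Backward σ (r i)
    step i bwd with local (r i)
    ... | inj₂ bwd′ = bwd′
    ... | inj₁ fwd′ = ⊥-elim (r-r-irreflexive 2<m i (perm-injective σ (trans fwd′ bwd)))

  parity-suc : ∀ n → parity (suc n) ≡ parity n ⁻¹
  parity-suc n = sym (⁻¹-selfInverse (suc-homo-⁻¹ n))

  even⇒1<m : parity m ≡ 0ℙ → 1 < m
  even⇒1<m m-even = s≤s (ℕ.n≢0⇒n>0 λ m′≡0 → case trans (cong (parity ∘ suc) (sym m′≡0)) m-even of λ ())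

  parity-r : parity m ≡ 0ℙ → ∀ i → parity (toℕ (r i)) ≡ parity (toℕ i) ⁻¹
  parity-r m-even i with inner-or-last i
  ... | inj₁ lt = trans (cong parity (toℕ-r-< lt)) (parity-suc (toℕ i))
  ... | inj₂ eq = begin
    parity (toℕ (r i))  ≡⟨ cong parity (toℕ-r-last eq) ⟩
    0ℙ                  ≡⟨ m-even ⟨
    parity m            ≡⟨ cong parity eq ⟨
    parity (suc (toℕ i)) ≡⟨ parity-suc (toℕ i) ⟩
    parity (toℕ i) ⁻¹   ∎

  twoPointColouring : Fin m → Fin m → Fin m → Maybe Parity
  twoPointColouring a b i = if does (i ≟ᶠ a) ∨ does (i ≟ᶠ b) then nothing else just (parity (toℕ i))

  module _ (a b : Fin m) where

    colouring-a : twoPointColouring a b a ≡ nothing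
    colouring-a with a ≟ᶠ a
    ... | yes _   = refl
    ... | no  a≢a = ⊥-elim (a≢a refl)

    colouring-b : twoPointColouring a b b ≡ nothing
    colouring-b with b ≟ᶠ a | b ≟ᶠ b
    ... | yes _ | _       = refl
    ... | no  _ | yes _   = refl
    ... | no  _ | no  b≢b = ⊥-elim (b≢b refl)

    colouring-nothing : ∀ i → twoPointColouring a b i ≡ nothing → i ≡ a ⊎ i ≡ b
    colouring-nothing i eq with i ≟ᶠ a | i ≟ᶠ b
    ... | yes i≡a | _       = inj₁ i≡a
    ... | no  _   | yes i≡b = inj₂ i≡b

    colouring-just : ∀ i {p} → twoPointColouring a b i ≡ just p → parity (toℕ i) ≡ p
    colouring-just i eq with i ≟ᶠ a | i ≟ᶠ b
    colouring-just i refl | no _ | no _ = refl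

    twoPointColouring-proper : parity m ≡ 0ℙ → r a ≢ b → r b ≢ a →
                               ∀ i → twoPointColouring a b i ≢ twoPointColouring a b (r i)
    twoPointColouring-proper m-even ra≢b rb≢a i same
      with twoPointColouring a b i in cᵢ | twoPointColouring a b (r i) in cᵣᵢ
    twoPointColouring-proper _ _ _ i () | just _ | nothing
    twoPointColouring-proper _ _ _ i () | nothing | just _
    twoPointColouring-proper m-even _ _ i refl | just p | just .p = p≢p⁻¹ p (begin
      p                    ≡⟨ colouring-just (r i) cᵣᵢ ⟨
      parity (toℕ (r i))   ≡⟨ parity-r m-even i ⟩
      parity (toℕ i) ⁻¹    ≡⟨ cong _⁻¹ (colouring-just i cᵢ) ⟩
      p ⁻¹                 ∎)
    twoPointColouring-proper m-even ra≢b rb≢a i refl | nothing | nothing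
      with colouring-nothing i cᵢ | colouring-nothing (r i) cᵣᵢ
    ... | inj₁ refl | inj₁ ri≡a = r-irreflexive (even⇒1<m m-even) a ri≡a
    ... | inj₁ refl | inj₂ ri≡b = ra≢b ri≡b
    ... | inj₂ refl | inj₁ ri≡a = rb≢a ri≡a
    ... | inj₂ refl | inj₂ ri≡b = r-irreflexive (even⇒1<m m-even) b ri≡b

module CyclePolynomial {c ℓ} (F : Field c ℓ) (m′ : ℕ) where
  open Cycle m′
  open Field F hiding (zero)
  open Poly F m
  open PolynomialFunctionals F m
  open FieldProperties F
  open CommutativeMonoid *ₚ-commutativeMonoid using (monoid; ∙-cong)
    renaming (setoid to ≃-setoid; sym to ≃-sym; trans to ≃-trans; reflexive to ≃-reflexive)
  open CommutativeMonoidSum *ₚ-commutativeMonoid using (∑-permute; ∑-distrib-+; sum-cong-≋)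
    renaming (sum to ∏ₚ)
  open CommutativeMonoidSum *-commutativeMonoid using () renaming (sum to product; sum-cong-≋ to product-cong)
  open import Relation.Binary.Reasoning.Setoid ≃-setoid

  cyclePoly : (Fin m → Fin m) → Polynomial
  cyclePoly f = ∏ₚ (λ i → diffVar (f i) (f (r i)))

  cyclePoly-cong : ∀ {f g} → (∀ i → f i ≡ g i) → cyclePoly f ≃ cyclePoly g
  cyclePoly-cong f≗g = sum-cong-≋ (λ i → ≃-reflexive (≡.cong₂ diffVar (f≗g i) (f≗g (r i))))

  cyclePoly-∘-r : ∀ f → cyclePoly (f ∘ r) ≃ cyclePoly f
  cyclePoly-∘-r f = ≃-sym (∑-permute (λ i → diffVar (f i) (f (r i))) rotation)

  cyclePoly-∘-s : parity m ≡ 0ℙ → ∀ f → cyclePoly (f ∘ s) ≃ cyclePoly f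
  cyclePoly-∘-s m-even f = begin
    cyclePoly (f ∘ s)                ≈⟨ sum-cong-≋ reflected-edge ⟩
    ∏ₚ (λ i → −1 *ₚ edge (s (r i)))  ≈⟨ ∑-distrib-+ (Vector.replicate m −1) (edge ∘ s ∘ r) ⟩
    ∏ₚ (Vector.replicate m −1) *ₚ ∏ₚ (edge ∘ s ∘ r)
      ≈⟨ ∙-cong (sum-replicate-involutive monoid {−1} m constant-[-1]² m-even)
                (≃-sym (∑-permute edge (rotation ∘ₚ reflection))) ⟩
    oneₚ *ₚ ∏ₚ edge                  ≈⟨ *ₚ-identityˡ _ ⟩
    cyclePoly f                      ∎
    where
    −1 = constant (- 1#)
    edge : Fin m → Polynomial
    edge i = diffVar (f i) (f (r i))
    reflected-edge : ∀ i → diffVar (f (s i)) (f (s (r i))) ≃ −1 *ₚ edge (s (r i))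
    reflected-edge i = ≃-trans
      (≃-reflexive (≡.cong (λ j → diffVar (f j) (f (s (r i)))) (≡.sym (r-s-r i))))
      (diffVar-antisym (f (s (r i))) (f (r (s (r i)))))

  cyclePoly-∘-dihedral : parity m ≡ 0ℙ → ∀ {σ} → InDihedral m σ →
                         ∀ f → cyclePoly (f ∘ (σ ⟨$⟩ʳ_)) ≃ cyclePoly f
  cyclePoly-∘-dihedral m-even (gen-id σ σ≗id) f = cyclePoly-cong (≡.cong f ∘ σ≗id)
  cyclePoly-∘-dihedral m-even (gen-rot σ σ≗r) f =
    ≃-trans (cyclePoly-cong (≡.cong f ∘ σ≗r)) (cyclePoly-∘-r f)
  cyclePoly-∘-dihedral m-even (gen-refl σ σ≗s) f =
    ≃-trans (cyclePoly-cong (≡.cong f ∘ σ≗s)) (cyclePoly-∘-s m-even f)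
  cyclePoly-∘-dihedral m-even (gen-comp σ τ ρ τ∈D ρ∈D σ≗τρ) f = begin
    cyclePoly (f ∘ (σ ⟨$⟩ʳ_))                    ≈⟨ cyclePoly-cong (≡.cong f ∘ σ≗τρ) ⟩
    cyclePoly (f ∘ (τ ⟨$⟩ʳ_) ∘ (ρ ⟨$⟩ʳ_))        ≈⟨ cyclePoly-∘-dihedral m-even ρ∈D (f ∘ (τ ⟨$⟩ʳ_)) ⟩
    cyclePoly (f ∘ (τ ⟨$⟩ʳ_))                    ≈⟨ cyclePoly-∘-dihedral m-even τ∈D f ⟩
    cyclePoly f                                  ∎
  cyclePoly-∘-dihedral m-even (gen-inv σ τ τ∈D σ≗τ⁻¹) f = begin
    cyclePoly (f ∘ (σ ⟨$⟩ʳ_))                    ≈⟨ cyclePoly-cong (≡.cong f ∘ σ≗τ⁻¹) ⟩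
    cyclePoly (f ∘ (τ ⟨$⟩ˡ_))                    ≈⟨ cyclePoly-∘-dihedral m-even τ∈D (f ∘ (τ ⟨$⟩ˡ_)) ⟨
    cyclePoly (f ∘ (τ ⟨$⟩ˡ_) ∘ (τ ⟨$⟩ʳ_))        ≈⟨ cyclePoly-cong (λ i → ≡.cong f (Perm.inverseˡ τ {i})) ⟩
    cyclePoly f                                  ∎

  eval-∏ₚ : ∀ v {n} (h : Fin n → Polynomial) → eval v (∏ₚ h) ≈ product (eval v ∘ h)
  eval-∏ₚ v {zero}  h = eval-oneₚ v
  eval-∏ₚ v {suc n} h = trans (eval-*ₚ v (h zero) _) (*-congˡ (eval-∏ₚ v (h ∘ suc)))

  eval-cyclePoly : ∀ v f → eval v (cyclePoly f) ≈ product (λ i → v (f i) - v (f (r i)))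
  eval-cyclePoly v f = trans (eval-∏ₚ v {m} (λ i → diffVar (f i) (f (r i))))
                             (product-cong (λ i → eval-diffVar v (f i) (f (r i))))

  cyclePoly-detects-nonadjacency : CharNot2 F → parity m ≡ 0ℙ → ∀ σ x →
    r (σ ⟨$⟩ʳ x) ≢ σ ⟨$⟩ʳ r x → r (σ ⟨$⟩ʳ r x) ≢ σ ⟨$⟩ʳ x → ¬ cyclePoly (σ ⟨$⟩ʳ_) ≃ cyclePoly id
  cyclePoly-detects-nonadjacency ch2 m-even σ x ra≢b rb≢a σ-preserves =
    g-nonzero (trans (sym (eval-cong v σ-preserves)) g∘σ-zero)
    where
    a = σ ⟨$⟩ʳ x
    b = σ ⟨$⟩ʳ r x
    v : Fin m → Carrier
    v = colourValue ∘ twoPointColouring a b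
    edge-x-vanishes : v a - v b ≈ 0#
    edge-x-vanishes = trans
      (reflexive (≡.cong₂ (λ p q → colourValue p - colourValue q) (colouring-a a b) (colouring-b a b)))
      (-‿inverseʳ 0#)
    g∘σ-zero : eval v (cyclePoly (σ ⟨$⟩ʳ_)) ≈ 0#
    g∘σ-zero = trans (eval-cyclePoly v (σ ⟨$⟩ʳ_))
                     (product-zero (λ i → v (σ ⟨$⟩ʳ i) - v (σ ⟨$⟩ʳ r i)) x edge-x-vanishes)
    g-nonzero : ¬ eval v (cyclePoly id) ≈ 0#
    g-nonzero = product-nonzero (λ i → v i - v (r i)) (λ i → difference-nonzero λ vi≈vri →
                  twoPointColouring-proper a b m-even ra≢b rb≢a i (colourValue-injective ch2 _ _ vi≈vri))
                ∘ trans (sym (eval-cyclePoly v id))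

  cyclePoly-preserved⇒locally-dihedral : CharNot2 F → parity m ≡ 0ℙ → ∀ σ →
    cyclePoly (σ ⟨$⟩ʳ_) ≃ cyclePoly id → ∀ x → Forward σ x ⊎ Backward σ x
  cyclePoly-preserved⇒locally-dihedral ch2 m-even σ σ-preserves x
    with r (σ ⟨$⟩ʳ x) ≟ᶠ σ ⟨$⟩ʳ r x | r (σ ⟨$⟩ʳ r x) ≟ᶠ σ ⟨$⟩ʳ x
  ... | yes ra≡b | _        = inj₁ (≡.sym ra≡b)
  ... | no  _    | yes rb≡a = inj₂ rb≡a
  ... | no  ra≢b | no rb≢a  = ⊥-elim (cyclePoly-detects-nonadjacency ch2 m-even σ x ra≢b rb≢a σ-preserves)

  gσ≡cyclePoly : ∀ σ → gσ F m σ ≡ cyclePoly (σ ⟨$⟩ʳ_)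
  gσ≡cyclePoly σ = foldr-map-allFin _*ₚ_ oneₚ (λ i → diffVar (σ ⟨$⟩ʳ i) (σ ⟨$⟩ʳ r i))

  g≡cyclePoly : g F m ≡ cyclePoly id
  g≡cyclePoly = foldr-map-allFin _*ₚ_ oneₚ (λ i → diffVar i (r i))

  InSym⇒cyclePoly-preserved : ∀ σ → InSym F m σ → cyclePoly (σ ⟨$⟩ʳ_) ≃ cyclePoly id
  InSym⇒cyclePoly-preserved σ σ∈Sym = ≡.subst₂ _≃_ (gσ≡cyclePoly σ) g≡cyclePoly (≈ₚ⇒≃ σ∈Sym)

  cyclePoly-preserved⇒InSym : ∀ σ → cyclePoly (σ ⟨$⟩ʳ_) ≃ cyclePoly id → InSym F m σ
  cyclePoly-preserved⇒InSym σ σ-preserves =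
    ≃⇒≈ₚ (≡.subst₂ _≃_ (≡.sym (gσ≡cyclePoly σ)) (≡.sym g≡cyclePoly) σ-preserves)

  Sym≡Dihedral : CharNot2 F → parity m ≡ 0ℙ → ∀ σ →
                 (InSym F m σ → InDihedral m σ) × (InDihedral m σ → InSym F m σ)
  Sym≡Dihedral ch2 m-even σ =
      (λ σ∈Sym → locally-dihedral⇒dihedral (even⇒1<m m-even) σ
                   (cyclePoly-preserved⇒locally-dihedral ch2 m-even σ (InSym⇒cyclePoly-preserved σ σ∈Sym)))
    , (λ σ∈D → cyclePoly-preserved⇒InSym σ (cyclePoly-∘-dihedral m-even σ∈D id))

lemma4p1 : ∀ {c ℓ} (F : Field c ℓ) → CharNot2 F → (k : ℕ) →
    let n = suc k in
    (σ : Permutation′ (2 ℕ.* n)) →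
      (InSym F (2 ℕ.* n) σ → InDihedral (2 ℕ.* n) σ) × (InDihedral (2 ℕ.* n) σ → InSym F (2 ℕ.* n) σ)
lemma4p1 F ch2 k = CyclePolynomial.Sym≡Dihedral F _ ch2 (*-homo-* 2 (suc k))
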